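{- Let $n\geq 3$. The critical group of any arithmetical structure on $D_n$ is cyclic.
   Context: For $n\ge 3$ let $\ell=n-3$. The bident $D_n$ has vertices $v_x,v_y,v_0,\dots,v_\ell$ and edges $v_xv_0$, $v_yv_0$, $v_iv_{i+1}$ ($0\le i\le\ell-1$). An arithmetical structure on a finite connected graph $G$ with $n$ vertices and adjacency matrix $A$ is a pair $(\mathbf d,\mathbf r)$ of positive integer vectors with $(\operatorname{diag}(\mathbf d)-A)\mathbf r=\mathbf 0$ and $\mathbf r$ primitive. The cokernel $\mathbb Z^n/\operatorname{Im}(\operatorname{diag}(\mathbf d)-A)$ is isomorphic to $\mathbb Z\oplus K$ with $K$ finite; $K$ is the critical group. -}

module Defs where

open import Data.Nat as ℕ using (ℕ; zero; suc; _<_)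
open import Data.Integer as ℤ using (ℤ; +_; _-_; _*_; _+_)
open import Data.Integer.Divisibility as ℤD using ()
open import Data.Nat.Divisibility as ℕD using ()
open import Data.Fin using (Fin; toℕ; zero; suc)
open import Data.Fin.Properties using (_≟_)
open import Data.Bool using (Bool; true; false; if_then_else_)
open import Data.Product using (Σ; ∃; _×_)
open import Relation.Nullary.Decidable using (⌊_⌋)
open import Relation.Binary.PropositionalEquality using (_≡_)

sumℤ : ∀ {n} → (Fin n → ℤ) → ℤ
sumℤ {zero}  f = + 0
sumℤ {suc n} f = f zero + sumℤ (λ i → f (suc i))

dot : ∀ {n} → (Fin n → ℤ) → (Fin n → ℤ) → ℤ
dot a x = sumℤ (λ i → a i * x i)

matVec : ∀ {n} → (Fin n → Fin n → ℤ) → (Fin n → ℤ) → Fin n → ℤ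
matVec M y i = dot (M i) y

pathAdj : ℕ → ℕ → Bool
pathAdj zero (suc zero) = true
pathAdj (suc zero) zero = true
pathAdj (suc a) (suc b) = pathAdj a b
pathAdj _ _ = false

-- Vertex numbering of the bident D_{ℓ+3}:
--   0 ↦ v_x, 1 ↦ v_y, k+2 ↦ v_k (0 ≤ k ≤ ℓ).
-- Edges: v_x v_0, v_y v_0, v_k v_{k+1}.
bidentAdjℕ : ℕ → ℕ → Bool
bidentAdjℕ 0 2 = true
bidentAdjℕ 2 0 = true
bidentAdjℕ 1 2 = true
bidentAdjℕ 2 1 = true
bidentAdjℕ (suc (suc a)) (suc (suc b)) = pathAdj a b
bidentAdjℕ _ _ = false

bidentAdj : (ℓ : ℕ) → Fin (3 ℕ.+ ℓ) → Fin (3 ℕ.+ ℓ) → ℤ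
bidentAdj ℓ i j = if bidentAdjℕ (toℕ i) (toℕ j) then + 1 else + 0

lapl : ∀ {n} → (Fin n → ℕ) → (Fin n → Fin n → ℤ) → Fin n → Fin n → ℤ
lapl d A i j = (if ⌊ i ≟ j ⌋ then + d i else + 0) - A i j

Primitive : ∀ {n} → (Fin n → ℕ) → Set
Primitive r = ∀ k → (∀ i → k ℕD.∣ r i) → k ℕD.∣ 1

IsArithmetical : ∀ {n} → (Fin n → Fin n → ℤ) → (Fin n → ℕ) → (Fin n → ℕ) → Set
IsArithmetical A d r =
  (∀ i → 0 < d i) × (∀ i → 0 < r i) ×
  (∀ i → matVec (lapl d A) (λ j → + r j) i ≡ + 0) ×
  Primitive r

-- The group homomorphism φ : ℤⁿ → ℤ ⊕ ℤ/mℤ, φ(x) = (a·x , b·x mod m),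
-- is surjective with kernel exactly Im M; i.e. φ induces an isomorphism
-- ℤⁿ / Im M ≅ ℤ ⊕ ℤ/mℤ.
InducesIso : ∀ {n} → (Fin n → Fin n → ℤ) → ℕ → (Fin n → ℤ) → (Fin n → ℤ) → Set
InducesIso M m a b =
  (∃ λ x → dot a x ≡ + 1 × (+ m) ℤD.∣ dot b x) ×
  (∃ λ x → dot a x ≡ + 0 × (+ m) ℤD.∣ (dot b x - + 1)) ×
  (∀ x → ((dot a x ≡ + 0 × (+ m) ℤD.∣ dot b x) → ∃ λ y → ∀ i → x i ≡ matVec M y i)
       × ((∃ λ y → ∀ i → x i ≡ matVec M y i) → (dot a x ≡ + 0 × (+ m) ℤD.∣ dot b x)))

-- The cokernel ℤⁿ / Im M is isomorphic to ℤ ⊕ ℤ/mℤ for some m ≥ 1,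
-- i.e. it is ℤ ⊕ K with K finite cyclic: the critical group is cyclic.
CriticalGroupCyclic : ∀ {n} → (Fin n → Fin n → ℤ) → Set
CriticalGroupCyclic M =
  Σ ℕ λ m → 0 < m × Σ (_ → ℤ) λ a → Σ (_ → ℤ) λ b → InducesIso M m a b

module Submission where

{-
The cokernel of the Laplacian M = diag(d) − A of the bident is generated by the classes of
two vertices, v_ℓ and v_x: elimination along the path v_0 … v_ℓ, whose off-diagonal entries
are −1, rewrites every x as M y + α e_{v_ℓ} + β e_{v_x} with y vanishing on the leaves v_x, v_y.
Since M is symmetric with M r = 0, the functional x ↦ r·x kills Im M, and primitivity of r
forces gcd(r_{v_ℓ}, r_{v_x}) = 1. So r· maps the cokernel onto ℤ, and its kernel there is
generated by the single class of r_{v_x} e_{v_ℓ} − r_{v_ℓ} e_{v_x}: the torsion is cyclic.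
Its order m comes from a functional b whose values at v_ℓ, v_x are Bézout coefficients of that
gcd. Because the twin leaves v_x, v_y have the same neighbour, M b is supported on them, m is
the gcd of its two values, and (r·, b· mod m) induces ℤⁿ / Im M ≅ ℤ ⊕ ℤ/m.
-}

open import Defs
open import Data.Nat as ℕ using (ℕ; zero; suc; _≤_; _<_; s≤s; z≤n)
import Data.Nat.Properties as ℕₚ
open import Data.Nat.GCD using (gcd; gcd-GCD; gcd[m,n]∣m; gcd[m,n]∣n; gcd[m,n]≢0; module Bézout)
import Data.Nat.Divisibility as ℕᵈ
import Data.Integer.Divisibility as ℤᵘ
open import Data.Integer as ℤ using (ℤ; +_; -_; _+_; _*_; _-_; 0ℤ; 1ℤ; -1ℤ; ∣_∣)
import Data.Integer.Properties as ℤₚ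
open import Data.Integer.Divisibility.Signed as ℤᵈ using (divides)
open import Data.Integer.Tactic.RingSolver using (solve-∀)
open import Algebra.Properties.Semiring.Sum ℤₚ.+-*-semiring
  using (sum; sum-cong-≗; sum-replicate-zero; ∑-distrib-+; ∑-comm; *-distribˡ-sum)
open import Data.Fin using (Fin; zero; suc; toℕ; fromℕ; fromℕ<; _≟_)
import Data.Fin.Properties as Finₚ
open import Data.Vec.Functional using (Vector)
open import Data.Bool using (true; false; if_then_else_)
open import Data.Product using (Σ; ∃; ∃₂; _×_; _,_; proj₁; proj₂)
open import Data.Sum using (inj₁; inj₂)
open import Function using (_∘_)
open import Relation.Nullary using (Dec; yes; no; contradiction)
open import Relation.Nullary.Decidable using (⌊_⌋)
open import Relation.Binary.PropositionalEquality

Matrix : ℕ → Set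
Matrix n = Fin n → Fin n → ℤ

Symmetric : ∀ {n} → Matrix n → Set
Symmetric M = ∀ i j → M i j ≡ M j i

e : ∀ {n} → Fin n → Vector ℤ n
e j i = if ⌊ i ≟ j ⌋ then 1ℤ else 0ℤ

e-other : ∀ {n} {i j : Fin n} → i ≢ j → e j i ≡ 0ℤ
e-other {i = i} {j} i≢j with i ≟ j
... | yes i≡j = contradiction i≡j i≢j
... | no _    = refl

-- The `with` only makes ⌊ suc i ≟ suc j ⌋ reduce.
e-suc : ∀ {n} (j i : Fin n) → e (suc j) (suc i) ≡ e j i
e-suc j i with i ≟ j
... | yes _ = refl
... | no _  = refl

sumℤ≡sum : ∀ {n} (f : Vector ℤ n) → sumℤ f ≡ sum f
sumℤ≡sum {zero}  f = refl
sumℤ≡sum {suc n} f = cong (λ s → f zero + s) (sumℤ≡sum (f ∘ suc))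

module _ {n : ℕ} where
  open ≡-Reasoning

  sumℤ-cong : {f g : Vector ℤ n} → (∀ i → f i ≡ g i) → sumℤ f ≡ sumℤ g
  sumℤ-cong {f} {g} f≗g = begin
    sumℤ f ≡⟨ sumℤ≡sum f ⟩
    sum f  ≡⟨ sum-cong-≗ f≗g ⟩
    sum g  ≡⟨ sumℤ≡sum g ⟨
    sumℤ g ∎

  sumℤ-zero : sumℤ {n} (λ _ → 0ℤ) ≡ 0ℤ
  sumℤ-zero = trans (sumℤ≡sum {n} (λ _ → 0ℤ)) (sum-replicate-zero n)

  sumℤ-+ : (f g : Vector ℤ n) → sumℤ (λ i → f i + g i) ≡ sumℤ f + sumℤ g
  sumℤ-+ f g = begin
    sumℤ (λ i → f i + g i) ≡⟨ sumℤ≡sum (λ i → f i + g i) ⟩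
    sum (λ i → f i + g i)  ≡⟨ ∑-distrib-+ f g ⟩
    sum f + sum g          ≡⟨ cong₂ _+_ (sumℤ≡sum f) (sumℤ≡sum g) ⟨
    sumℤ f + sumℤ g        ∎

  sumℤ-*ˡ : (k : ℤ) (f : Vector ℤ n) → sumℤ (λ i → k * f i) ≡ k * sumℤ f
  sumℤ-*ˡ k f = begin
    sumℤ (λ i → k * f i) ≡⟨ sumℤ≡sum (λ i → k * f i) ⟩
    sum (λ i → k * f i)  ≡⟨ *-distribˡ-sum k f ⟨
    k * sum f            ≡⟨ cong (k *_) (sumℤ≡sum f) ⟨
    k * sumℤ f           ∎

sumℤ-∣ : ∀ {n k} {f : Vector ℤ n} → (∀ i → k ℤᵈ.∣ f i) → k ℤᵈ.∣ sumℤ f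
sumℤ-∣ {zero}  k∣f = divides 0ℤ refl
sumℤ-∣ {suc n} k∣f = ℤᵈ.∣m∣n⇒∣m+n (k∣f zero) (sumℤ-∣ (k∣f ∘ suc))

sumℤ-comm : ∀ {m n} (f : Fin m → Fin n → ℤ) →
            sumℤ (λ i → sumℤ (f i)) ≡ sumℤ (λ j → sumℤ (λ i → f i j))
sumℤ-comm f = begin
  sumℤ (λ i → sumℤ (f i))              ≡⟨ sumℤ-cong (λ i → sumℤ≡sum (f i)) ⟩
  sumℤ (λ i → sum (f i))               ≡⟨ sumℤ≡sum (λ i → sum (f i)) ⟩
  sum (λ i → sum (f i))                ≡⟨ ∑-comm f ⟩
  sum (λ j → sum (λ i → f i j))        ≡⟨ sumℤ≡sum (λ j → sum (λ i → f i j)) ⟨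
  sumℤ (λ j → sum (λ i → f i j))       ≡⟨ sumℤ-cong (λ j → sumℤ≡sum (λ i → f i j)) ⟨
  sumℤ (λ j → sumℤ (λ i → f i j))      ∎
  where open ≡-Reasoning

module _ {n : ℕ} where

  dot-cong : {a a′ x x′ : Vector ℤ n} → (∀ i → a i ≡ a′ i) → (∀ i → x i ≡ x′ i) →
             dot a x ≡ dot a′ x′
  dot-cong a≗a′ x≗x′ = sumℤ-cong (λ i → cong₂ _*_ (a≗a′ i) (x≗x′ i))

  dot-zeroˡ : (x : Vector ℤ n) → dot (λ _ → 0ℤ) x ≡ 0ℤ
  dot-zeroˡ x = trans (sumℤ-cong (λ i → ℤₚ.*-zeroˡ (x i))) (sumℤ-zero {n})

  dot-zeroʳ : (a : Vector ℤ n) → dot a (λ _ → 0ℤ) ≡ 0ℤ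
  dot-zeroʳ a = trans (sumℤ-cong (λ i → ℤₚ.*-zeroʳ (a i))) (sumℤ-zero {n})

  dot-+ʳ : (a x y : Vector ℤ n) → dot a (λ i → x i + y i) ≡ dot a x + dot a y
  dot-+ʳ a x y = trans (sumℤ-cong (λ i → ℤₚ.*-distribˡ-+ (a i) (x i) (y i)))
                       (sumℤ-+ (λ i → a i * x i) (λ i → a i * y i))

  dot-*ʳ : (a x : Vector ℤ n) (k : ℤ) → dot a (λ i → k * x i) ≡ k * dot a x
  dot-*ʳ a x k = trans (sumℤ-cong (λ i → swap (a i) k (x i))) (sumℤ-*ˡ k (λ i → a i * x i))
    where
    swap : ∀ a k x → a * (k * x) ≡ k * (a * x)
    swap = solve-∀

  dot-comm : (a x : Vector ℤ n) → dot a x ≡ dot x a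
  dot-comm a x = sumℤ-cong (λ i → ℤₚ.*-comm (a i) (x i))

  dot-∣ : ∀ {k} (a x : Vector ℤ n) → (∀ i → k ℤᵈ.∣ a i) → k ℤᵈ.∣ dot a x
  dot-∣ a x k∣a = sumℤ-∣ (λ i → ℤᵈ.∣m⇒∣m*n (x i) (k∣a i))

dot-e : ∀ {n} (a : Vector ℤ n) (j : Fin n) → dot a (e j) ≡ a j
dot-e {suc n} a zero = begin
  a zero * 1ℤ + sumℤ (λ i → a (suc i) * 0ℤ) ≡⟨ cong (λ s → a zero * 1ℤ + s) (dot-zeroʳ (a ∘ suc)) ⟩
  a zero * 1ℤ + 0ℤ                          ≡⟨ unit (a zero) ⟩
  a zero                                    ∎
  where
  open ≡-Reasoning
  unit : ∀ a → a * 1ℤ + 0ℤ ≡ a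
  unit = solve-∀
dot-e {suc n} a (suc j) = begin
  a zero * 0ℤ + dot (a ∘ suc) (λ i → e (suc j) (suc i))
    ≡⟨ cong₂ _+_ (ℤₚ.*-zeroʳ (a zero)) (dot-cong {a = a ∘ suc} (λ _ → refl) (e-suc j)) ⟩
  0ℤ + dot (a ∘ suc) (e j)
    ≡⟨ ℤₚ.+-identityˡ _ ⟩
  dot (a ∘ suc) (e j)
    ≡⟨ dot-e (a ∘ suc) j ⟩
  a (suc j) ∎
  where open ≡-Reasoning

module _ {n : ℕ} (M : Matrix n) where

  matVec-cong : {y y′ : Vector ℤ n} → (∀ j → y j ≡ y′ j) → ∀ i → matVec M y i ≡ matVec M y′ i
  matVec-cong y≗y′ i = dot-cong {a = M i} (λ _ → refl) y≗y′

  matVec-+ : (y y′ : Vector ℤ n) → ∀ i → matVec M (λ j → y j + y′ j) i ≡ matVec M y i + matVec M y′ i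
  matVec-+ y y′ i = dot-+ʳ (M i) y y′

  matVec-* : (k : ℤ) (y : Vector ℤ n) → ∀ i → matVec M (λ j → k * y j) i ≡ k * matVec M y i
  matVec-* k y i = dot-*ʳ (M i) y k

  matVec-e : (j i : Fin n) → matVec M (e j) i ≡ M i j
  matVec-e j i = dot-e (M i) j

  dot-matVec : Symmetric M → (a y : Vector ℤ n) → dot a (matVec M y) ≡ dot (matVec M a) y
  dot-matVec M-sym a y = begin
    sumℤ (λ i → a i * sumℤ (λ j → M i j * y j))
      ≡⟨ sumℤ-cong (λ i → sumℤ-*ˡ (a i) (λ j → M i j * y j)) ⟨
    sumℤ (λ i → sumℤ (λ j → a i * (M i j * y j)))
      ≡⟨ sumℤ-comm (λ i j → a i * (M i j * y j)) ⟩
    sumℤ (λ j → sumℤ (λ i → a i * (M i j * y j)))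
      ≡⟨ sumℤ-cong (λ j → sumℤ-cong (λ i → transpose i j)) ⟩
    sumℤ (λ j → sumℤ (λ i → y j * (M j i * a i)))
      ≡⟨ sumℤ-cong (λ j → sumℤ-*ˡ (y j) (λ i → M j i * a i)) ⟩
    sumℤ (λ j → y j * sumℤ (λ i → M j i * a i))
      ≡⟨ sumℤ-cong (λ j → ℤₚ.*-comm (y j) _) ⟩
    sumℤ (λ j → sumℤ (λ i → M j i * a i) * y j) ∎
    where
    open ≡-Reasoning
    regroup : ∀ a y m → a * (m * y) ≡ y * (m * a)
    regroup = solve-∀
    transpose : ∀ i j → a i * (M i j * y j) ≡ y j * (M j i * a i)
    transpose i j = trans (regroup (a i) (y j) (M i j)) (cong (λ m → y j * (m * a i)) (M-sym i j))

comb : ∀ {n} → Fin n → Fin n → ℤ → ℤ → Vector ℤ n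
comb a c α β i = α * e a i + β * e c i

dot-comb : ∀ {n} (w : Vector ℤ n) (a c : Fin n) (α β : ℤ) → dot w (comb a c α β) ≡ α * w a + β * w c
dot-comb w a c α β = begin
  dot w (comb a c α β)                                ≡⟨ dot-+ʳ w (λ i → α * e a i) (λ i → β * e c i) ⟩
  dot w (λ i → α * e a i) + dot w (λ i → β * e c i)  ≡⟨ cong₂ _+_ (dot-*ʳ w (e a) α) (dot-*ʳ w (e c) β) ⟩
  α * dot w (e a) + β * dot w (e c)                  ≡⟨ cong₂ (λ s t → α * s + β * t) (dot-e w a) (dot-e w c) ⟩
  α * w a + β * w c                                  ∎
  where open ≡-Reasoning

record Representation {n} (M : Matrix n) (a c : Fin n) (x : Vector ℤ n) : Set where
  field
    y          : Vector ℤ n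
    α β        : ℤ
    represents : ∀ i → x i ≡ matVec M y i + comb a c α β i

dot-representation : ∀ {n} {M : Matrix n} {a c : Fin n} {x : Vector ℤ n} → Symmetric M →
                     (ρ : Representation M a c x) (w : Vector ℤ n) →
                     let open Representation ρ in
                     dot w x ≡ dot (matVec M w) y + (α * w a + β * w c)
dot-representation {M = M} {a} {c} {x} M-sym ρ w = begin
  dot w x                                               ≡⟨ dot-cong {a = w} (λ _ → refl) represents ⟩
  dot w (λ i → matVec M y i + comb a c α β i)          ≡⟨ dot-+ʳ w (matVec M y) (comb a c α β) ⟩
  dot w (matVec M y) + dot w (comb a c α β)            ≡⟨ cong₂ _+_ (dot-matVec M M-sym w y) (dot-comb w a c α β) ⟩
  dot (matVec M w) y + (α * w a + β * w c)             ∎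
  where
  open ≡-Reasoning
  open Representation ρ

orthogonal-to-unimodular : ∀ {A C u v α β : ℤ} → u * C - v * A ≡ 1ℤ → α * A + β * C ≡ 0ℤ →
                           α ≡ (α * u + β * v) * C × β ≡ - ((α * u + β * v) * A)
orthogonal-to-unimodular {A} {C} {u} {v} {α} {β} uv αβ⊥ =
  sym (begin
    (α * u + β * v) * C                               ≡⟨ expandα α β u v A C ⟩
    α * (u * C - v * A) + v * (α * A + β * C)         ≡⟨ cong₂ (λ s t → α * s + v * t) uv αβ⊥ ⟩
    α * 1ℤ + v * 0ℤ                                   ≡⟨ collapse α v ⟩
    α                                                 ∎) ,
  sym (begin
    - ((α * u + β * v) * A)                           ≡⟨ expandβ α β u v A C ⟩
    β * (u * C - v * A) - u * (α * A + β * C)         ≡⟨ cong₂ (λ s t → β * s - u * t) uv αβ⊥ ⟩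
    β * 1ℤ - u * 0ℤ                                   ≡⟨ collapse′ β u ⟩
    β                                                 ∎)
  where
  open ≡-Reasoning
  expandα : ∀ α β u v A C → (α * u + β * v) * C ≡ α * (u * C - v * A) + v * (α * A + β * C)
  expandα = solve-∀
  expandβ : ∀ α β u v A C → - ((α * u + β * v) * A) ≡ β * (u * C - v * A) - u * (α * A + β * C)
  expandβ = solve-∀
  collapse : ∀ α v → α * 1ℤ + v * 0ℤ ≡ α
  collapse = solve-∀
  collapse′ : ∀ β u → β * 1ℤ - u * 0ℤ ≡ β
  collapse′ = solve-∀

ℕ-affine-toℤ : ∀ g y b x a → g ℕ.+ y ℕ.* b ≡ x ℕ.* a → + g + + y * + b ≡ + x * + a
ℕ-affine-toℤ g y b x a eq = begin
  + g + + y * + b      ≡⟨ cong (λ s → + g + s) (ℤₚ.pos-* y b) ⟨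
  + g + + (y ℕ.* b)    ≡⟨ ℤₚ.pos-+ g (y ℕ.* b) ⟨
  + (g ℕ.+ y ℕ.* b)    ≡⟨ cong +_ eq ⟩
  + (x ℕ.* a)          ≡⟨ ℤₚ.pos-* x a ⟩
  + x * + a            ∎
  where open ≡-Reasoning

bézout-ℕ : ∀ a b → ∃₂ λ σ τ → + gcd a b ≡ σ * + a + τ * + b
bézout-ℕ a b with gcd a b | Bézout.identity (gcd-GCD a b)
... | g | Bézout.+- x y eq =
  + x , - + y , trans (move (+ g) (+ y) (+ b)) (cong (λ s → s + - + y * + b) (ℕ-affine-toℤ g y b x a eq))
  where
  move : ∀ g y b → g ≡ (g + y * b) + - y * b
  move = solve-∀
... | g | Bézout.-+ x y eq =
  - + x , + y , trans (move (+ g) (+ x) (+ a)) (cong (λ s → - + x * + a + s) (ℕ-affine-toℤ g x a y b eq))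
  where
  move : ∀ g x a → g ≡ - x * a + (g + x * a)
  move = solve-∀

+∣∣-as-multiple : ∀ i → ∃ λ s → + ∣ i ∣ ≡ s * i
+∣∣-as-multiple i with ℤₚ.+∣i∣≡i⊎+∣i∣≡-i i
... | inj₁ eq = 1ℤ , trans eq (sym (ℤₚ.*-identityˡ i))
... | inj₂ eq = -1ℤ , trans eq (sym (ℤₚ.-1*i≡-i i))

bézout : ∀ i j → ∃₂ λ σ τ → + gcd ∣ i ∣ ∣ j ∣ ≡ σ * i + τ * j
bézout i j with bézout-ℕ ∣ i ∣ ∣ j ∣ | +∣∣-as-multiple i | +∣∣-as-multiple j
... | σ , τ , eq | s , si | t , tj = σ * s , τ * t , (begin
  + gcd ∣ i ∣ ∣ j ∣              ≡⟨ eq ⟩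
  σ * + ∣ i ∣ + τ * + ∣ j ∣      ≡⟨ cong₂ (λ p q → σ * p + τ * q) si tj ⟩
  σ * (s * i) + τ * (t * j)      ≡⟨ reassoc σ s i τ t j ⟩
  σ * s * i + τ * t * j          ∎)
  where
  open ≡-Reasoning
  reassoc : ∀ σ s i τ t j → σ * (s * i) + τ * (t * j) ≡ σ * s * i + τ * t * j
  reassoc = solve-∀

gcd-∣ˡ : ∀ i j → + gcd ∣ i ∣ ∣ j ∣ ℤᵈ.∣ i
gcd-∣ˡ i j = ℤᵈ.∣ᵤ⇒∣ (gcd[m,n]∣m ∣ i ∣ ∣ j ∣)

gcd-∣ʳ : ∀ i j → + gcd ∣ i ∣ ∣ j ∣ ℤᵈ.∣ j
gcd-∣ʳ i j = ℤᵈ.∣ᵤ⇒∣ (gcd[m,n]∣n ∣ i ∣ ∣ j ∣)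

module TwoGeneratedCokernel {n} (M : Matrix n) (M-sym : Symmetric M)
  (R : Vector ℤ n) (MR≡0 : ∀ i → matVec M R i ≡ 0ℤ)
  (a c : Fin n) (reduce : ∀ x → Representation M a c x) where

  dot-MR : ∀ y → dot (matVec M R) y ≡ 0ℤ
  dot-MR y = trans (dot-cong MR≡0 (λ _ → refl)) (dot-zeroˡ y)

  R-image : ∀ y → dot R (matVec M y) ≡ 0ℤ
  R-image y = trans (dot-matVec M M-sym R y) (dot-MR y)

  R-representation : ∀ {x} (ρ : Representation M a c x) →
                     let open Representation ρ in dot R x ≡ α * R a + β * R c
  R-representation {x} ρ = begin
    dot R x                                       ≡⟨ dot-representation M-sym ρ R ⟩
    dot (matVec M R) y + (α * R a + β * R c)      ≡⟨ cong (_+ (α * R a + β * R c)) (dot-MR y) ⟩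
    0ℤ + (α * R a + β * R c)                      ≡⟨ ℤₚ.+-identityˡ _ ⟩
    α * R a + β * R c                             ∎
    where
    open ≡-Reasoning
    open Representation ρ

  gcd-∣-R : ∀ i → gcd ∣ R a ∣ ∣ R c ∣ ℕᵈ.∣ ∣ R i ∣
  gcd-∣-R i = ℤᵈ.∣⇒∣ᵤ (subst (+ g ℤᵈ.∣_) R-at-i
    (ℤᵈ.∣m∣n⇒∣m+n (ℤᵈ.∣n⇒∣m*n α (gcd-∣ˡ (R a) (R c))) (ℤᵈ.∣n⇒∣m*n β (gcd-∣ʳ (R a) (R c)))))
    where
    g : ℕ
    g = gcd ∣ R a ∣ ∣ R c ∣
    open Representation (reduce (e i))
    R-at-i : α * R a + β * R c ≡ R i
    R-at-i = trans (sym (R-representation (reduce (e i)))) (dot-e R i)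

  -- m ∣ M b makes b· well defined modulo m on the cokernel, and z shows that m kills the
  -- class of R c e_a − R a e_c, which generates the kernel of R·.
  module _ {u v : ℤ} (uv : u * R c - v * R a ≡ 1ℤ)
           (b : Vector ℤ n) (b-a : b a ≡ u) (b-c : b c ≡ v)
           (m : ℕ) (m>0 : 0 < m) (m∣Mb : ∀ j → + m ℤᵈ.∣ matVec M b j)
           (z : Vector ℤ n) (Mz : ∀ i → matVec M z i ≡ comb a c (+ m * R c) (- (+ m * R a)) i) where

    b-at : ∀ α β → α * b a + β * b c ≡ α * u + β * v
    b-at α β = cong₂ (λ s t → α * s + β * t) b-a b-c

    b-comb : ∀ α β → dot b (comb a c α β) ≡ α * u + β * v
    b-comb α β = trans (dot-comb b a c α β) (b-at α β)

    m∣b-image : ∀ y → + m ℤᵈ.∣ dot b (matVec M y)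
    m∣b-image y = subst (+ m ℤᵈ.∣_) (sym (dot-matVec M M-sym b y)) (dot-∣ (matVec M b) y m∣Mb)

    image⇒kernel : ∀ x → (∃ λ y → ∀ i → x i ≡ matVec M y i) → dot R x ≡ + 0 × + m ℤᵘ.∣ dot b x
    image⇒kernel x (y , x≡My) =
      trans (dot-cong {a = R} (λ _ → refl) x≡My) (R-image y) ,
      ℤᵈ.∣⇒∣ᵤ (subst (+ m ℤᵈ.∣_) (sym (dot-cong {a = b} (λ _ → refl) x≡My)) (m∣b-image y))

    kernel⇒image : ∀ x → dot R x ≡ + 0 × + m ℤᵘ.∣ dot b x → ∃ λ y → ∀ i → x i ≡ matVec M y i
    kernel⇒image x (Rx≡0 , m∣bx) = (λ j → y j + μ * z j) , x≡M[y+μz]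
      where
      open Representation (reduce x)
      open ≡-Reasoning
      t : ℤ
      t = α * u + β * v
      αβ-multiple : α ≡ t * R c × β ≡ - (t * R a)
      αβ-multiple = orthogonal-to-unimodular {R a} {R c} {u} {v} {α} {β} uv
                      (trans (sym (R-representation (reduce x))) Rx≡0)
      bx : dot b x ≡ dot (matVec M b) y + t
      bx = trans (dot-representation M-sym (reduce x) b) (cong (λ s → dot (matVec M b) y + s) (b-at α β))
      m∣t : + m ℤᵈ.∣ t
      m∣t = ℤᵈ.∣m+n∣m⇒∣n (subst (+ m ℤᵈ.∣_) bx (ℤᵈ.∣ᵤ⇒∣ m∣bx)) (dot-∣ (matVec M b) y m∣Mb)
      μ : ℤ
      μ = ℤᵈ._∣_.quotient m∣t
      comb-multiple : ∀ i → comb a c α β i ≡ μ * matVec M z i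
      comb-multiple i = begin
        α * e a i + β * e c i
          ≡⟨ cong₂ (λ s t → s * e a i + t * e c i) (proj₁ αβ-multiple) (proj₂ αβ-multiple) ⟩
        t * R c * e a i + - (t * R a) * e c i
          ≡⟨ cong (λ s → s * R c * e a i + - (s * R a) * e c i) (ℤᵈ._∣_.equality m∣t) ⟩
        μ * + m * R c * e a i + - (μ * + m * R a) * e c i
          ≡⟨ factor μ (+ m) (R a) (R c) (e a i) (e c i) ⟩
        μ * comb a c (+ m * R c) (- (+ m * R a)) i
          ≡⟨ cong (μ *_) (Mz i) ⟨
        μ * matVec M z i ∎
        where
        factor : ∀ μ m A C ea ec → μ * m * C * ea + - (μ * m * A) * ec ≡ μ * (m * C * ea + - (m * A) * ec)
        factor = solve-∀
      x≡M[y+μz] : ∀ i → x i ≡ matVec M (λ j → y j + μ * z j) i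
      x≡M[y+μz] i = begin
        x i                                         ≡⟨ represents i ⟩
        matVec M y i + comb a c α β i               ≡⟨ cong (λ s → matVec M y i + s) (comb-multiple i) ⟩
        matVec M y i + μ * matVec M z i             ≡⟨ cong (λ s → matVec M y i + s) (matVec-* M μ z i) ⟨
        matVec M y i + matVec M (λ j → μ * z j) i   ≡⟨ matVec-+ M y (λ j → μ * z j) i ⟨
        matVec M (λ j → y j + μ * z j) i            ∎

    section-R : ∃ λ x → dot R x ≡ + 1 × + m ℤᵘ.∣ dot b x
    section-R = comb a c (- v) u ,
      trans (dot-comb R a c (- v) u) (trans (reorder u v (R a) (R c)) uv) ,
      subst (+ m ℤᵘ.∣_) (sym (trans (b-comb (- v) u) (cancel u v))) (m ℕᵈ.∣0)
      where
      reorder : ∀ u v A C → - v * A + u * C ≡ u * C - v * A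
      reorder = solve-∀
      cancel : ∀ u v → - v * u + u * v ≡ 0ℤ
      cancel = solve-∀

    section-torsion : ∃ λ x → dot R x ≡ + 0 × + m ℤᵘ.∣ (dot b x - + 1)
    section-torsion = comb a c (R c) (- R a) ,
      trans (dot-comb R a c (R c) (- R a)) (cancel (R a) (R c)) ,
      subst (+ m ℤᵘ.∣_) (sym (trans (cong (_- + 1) (b-comb (R c) (- R a)))
                                     (trans (reorder u v (R a) (R c)) (cong (_- + 1) uv))))
            (m ℕᵈ.∣0)
      where
      cancel : ∀ A C → C * A + - A * C ≡ 0ℤ
      cancel = solve-∀
      reorder : ∀ u v A C → (C * u + - A * v) - + 1 ≡ (u * C - v * A) - + 1
      reorder = solve-∀

    cyclic : CriticalGroupCyclic M
    cyclic = m , m>0 , R , b , section-R , section-torsion , λ x → kernel⇒image x , image⇒kernel x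

unfire : ∀ {n} {M : Matrix n} {a c : Fin n} {x : Vector ℤ n} (k : ℤ) (col : Fin n) →
         Representation M a c (λ i → x i + k * M i col) → Representation M a c x
unfire {M = M} {a} {c} {x} k col ρ = record
  { y = λ j → y j + - k * e col j ; α = α ; β = β ; represents = represents′ }
  where
  open Representation ρ
  open ≡-Reasoning
  represents′ : ∀ i → x i ≡ matVec M (λ j → y j + - k * e col j) i + comb a c α β i
  represents′ i = begin
    x i
      ≡⟨ unshift (x i) k (M i col) ⟩
    (x i + k * M i col) + - k * M i col
      ≡⟨ cong (_+ - k * M i col) (represents i) ⟩
    (matVec M y i + comb a c α β i) + - k * M i col
      ≡⟨ swap (matVec M y i) (comb a c α β i) (- k * M i col) ⟩
    (matVec M y i + - k * M i col) + comb a c α β i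
      ≡⟨ cong (λ s → matVec M y i + - k * s + comb a c α β i) (matVec-e M col i) ⟨
    (matVec M y i + - k * matVec M (e col) i) + comb a c α β i
      ≡⟨ cong (_+ comb a c α β i) (cong (λ s → matVec M y i + s) (matVec-* M (- k) (e col) i)) ⟨
    (matVec M y i + matVec M (λ j → - k * e col j) i) + comb a c α β i
      ≡⟨ cong (_+ comb a c α β i) (matVec-+ M y (λ j → - k * e col j) i) ⟨
    matVec M (λ j → y j + - k * e col j) i + comb a c α β i ∎
    where
    unshift : ∀ x k m → x ≡ (x + k * m) + - k * m
    unshift = solve-∀
    swap : ∀ p q s → (p + q) + s ≡ (p + s) + q
    swap = solve-∀

lapl-offdiag : ∀ {n} (d : Fin n → ℕ) (A : Matrix n) {i j : Fin n} → i ≢ j → lapl d A i j ≡ - A i j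
lapl-offdiag d A {i} {j} i≢j with i ≟ j
... | yes i≡j = contradiction i≡j i≢j
... | no _    = ℤₚ.+-identityˡ (- A i j)

lapl-symmetric : ∀ {n} (d : Fin n → ℕ) {A : Matrix n} → Symmetric A → Symmetric (lapl d A)
lapl-symmetric d {A} A-sym i j = by-cases (i ≟ j)
  where
  open ≡-Reasoning
  by-cases : Dec (i ≡ j) → lapl d A i j ≡ lapl d A j i
  by-cases (yes refl) = refl
  by-cases (no i≢j)   = begin
    lapl d A i j  ≡⟨ lapl-offdiag d A i≢j ⟩
    - A i j       ≡⟨ cong -_ (A-sym i j) ⟩
    - A j i       ≡⟨ lapl-offdiag d A (i≢j ∘ sym) ⟨
    lapl d A j i  ∎

-- Not definitional: pathAdj and bidentAdjℕ first split on their small arguments.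
pathAdj-suc : ∀ a b → pathAdj (suc a) (suc b) ≡ pathAdj a b
pathAdj-suc zero    zero    = refl
pathAdj-suc zero    (suc b) = refl
pathAdj-suc (suc a) zero    = refl
pathAdj-suc (suc a) (suc b) = refl

pathAdj-sym : ∀ a b → pathAdj a b ≡ pathAdj b a
pathAdj-sym zero          zero          = refl
pathAdj-sym zero          (suc zero)    = refl
pathAdj-sym zero          (suc (suc b)) = refl
pathAdj-sym (suc zero)    zero          = refl
pathAdj-sym (suc (suc a)) zero          = refl
pathAdj-sym (suc a)       (suc b)       =
  trans (pathAdj-suc a b) (trans (pathAdj-sym a b) (sym (pathAdj-suc b a)))

pathAdj-next : ∀ a → pathAdj a (suc a) ≡ true
pathAdj-next zero    = refl
pathAdj-next (suc a) = trans (pathAdj-suc a (suc a)) (pathAdj-next a)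

pathAdj-far : ∀ a b → 2 ℕ.+ a ≤ b → pathAdj a b ≡ false
pathAdj-far zero    (suc zero)    (s≤s ())
pathAdj-far zero    (suc (suc b)) _         = refl
pathAdj-far (suc a) (suc b)       (s≤s a<b) = trans (pathAdj-suc a b) (pathAdj-far a b a<b)

bidentAdjℕ-path : ∀ a b → bidentAdjℕ (2 ℕ.+ a) (2 ℕ.+ b) ≡ pathAdj a b
bidentAdjℕ-path zero    zero    = refl
bidentAdjℕ-path zero    (suc b) = refl
bidentAdjℕ-path (suc a) zero    = refl
bidentAdjℕ-path (suc a) (suc b) = refl

bidentAdjℕ-sym : ∀ a b → bidentAdjℕ a b ≡ bidentAdjℕ b a
bidentAdjℕ-sym 0             0             = refl
bidentAdjℕ-sym 0             1             = refl
bidentAdjℕ-sym 0             2             = refl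
bidentAdjℕ-sym 0             (suc (suc (suc b))) = refl
bidentAdjℕ-sym 1             0             = refl
bidentAdjℕ-sym 1             1             = refl
bidentAdjℕ-sym 1             2             = refl
bidentAdjℕ-sym 1             (suc (suc (suc b))) = refl
bidentAdjℕ-sym 2             0             = refl
bidentAdjℕ-sym (suc (suc (suc a))) 0       = refl
bidentAdjℕ-sym 2             1             = refl
bidentAdjℕ-sym (suc (suc (suc a))) 1       = refl
bidentAdjℕ-sym (suc (suc a)) (suc (suc b)) =
  trans (bidentAdjℕ-path a b) (trans (pathAdj-sym a b) (sym (bidentAdjℕ-path b a)))

bidentAdjℕ-next : ∀ k → 1 ≤ k → bidentAdjℕ k (suc k) ≡ true
bidentAdjℕ-next 1             _ = refl
bidentAdjℕ-next (suc (suc a)) _ = trans (bidentAdjℕ-path a (suc a)) (pathAdj-next a)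

bidentAdjℕ-far : ∀ i j → 1 ≤ i → 2 ℕ.+ i ≤ j → bidentAdjℕ i j ≡ false
bidentAdjℕ-far 1             1                   _ (s≤s ())
bidentAdjℕ-far 1             2                   _ (s≤s (s≤s ()))
bidentAdjℕ-far 1             (suc (suc (suc j))) _ _                 = refl
bidentAdjℕ-far (suc (suc a)) (suc (suc b))       _ (s≤s (s≤s a+2≤b)) =
  trans (bidentAdjℕ-path a b) (pathAdj-far a b a+2≤b)

bidentAdjℕ-twins : ∀ k → bidentAdjℕ (2 ℕ.+ k) 0 ≡ bidentAdjℕ (2 ℕ.+ k) 1
bidentAdjℕ-twins zero    = refl
bidentAdjℕ-twins (suc k) = refl

module Bident (ℓ : ℕ) (d : Fin (3 ℕ.+ ℓ) → ℕ) where

  M : Matrix (3 ℕ.+ ℓ)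
  M = lapl d (bidentAdj ℓ)

  X Y last : Fin (3 ℕ.+ ℓ)
  X    = zero
  Y    = suc zero
  last = fromℕ (2 ℕ.+ ℓ)

  M-sym : Symmetric M
  M-sym = lapl-symmetric d (λ i j → cong (λ t → if t then 1ℤ else 0ℤ) (bidentAdjℕ-sym (toℕ i) (toℕ j)))

  M-offdiag : ∀ {i j} → toℕ i < toℕ j → M i j ≡ - (if bidentAdjℕ (toℕ i) (toℕ j) then 1ℤ else 0ℤ)
  M-offdiag i<j = lapl-offdiag d (bidentAdj ℓ) (ℕₚ.<⇒≢ i<j ∘ cong toℕ)

  M-next : ∀ {i j} → 1 ≤ toℕ i → toℕ j ≡ suc (toℕ i) → M i j ≡ -1ℤ
  M-next {i} {j} 1≤i j≡1+i = trans (M-offdiag (ℕₚ.≤-reflexive (sym j≡1+i)))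
    (cong (λ t → - (if t then 1ℤ else 0ℤ)) (trans (cong (bidentAdjℕ (toℕ i)) j≡1+i) (bidentAdjℕ-next (toℕ i) 1≤i)))

  M-far : ∀ {i j} → 1 ≤ toℕ i → 2 ℕ.+ toℕ i ≤ toℕ j → M i j ≡ 0ℤ
  M-far {i} {j} 1≤i i+2≤j = trans (M-offdiag (ℕₚ.≤-trans (ℕₚ.n≤1+n _) i+2≤j))
    (cong (λ t → - (if t then 1ℤ else 0ℤ)) (bidentAdjℕ-far (toℕ i) (toℕ j) 1≤i i+2≤j))

  twin-leaves : ∀ j → 1ℤ * M j X + -1ℤ * M j Y ≡ comb X Y (+ d X) (- + d Y) j
  twin-leaves zero          = atX (+ d X) (+ d Y)
    where
    atX : ∀ p q → 1ℤ * (p - + 0) + -1ℤ * (+ 0 - + 0) ≡ p * 1ℤ + - q * 0ℤ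
    atX = solve-∀
  twin-leaves (suc zero)    = atY (+ d X) (+ d Y)
    where
    atY : ∀ p q → 1ℤ * (+ 0 - + 0) + -1ℤ * (q - + 0) ≡ p * 0ℤ + - q * 1ℤ
    atY = solve-∀
  twin-leaves (suc (suc k)) rewrite bidentAdjℕ-twins (toℕ k) =
    elsewhere (if bidentAdjℕ (2 ℕ.+ toℕ k) 1 then 1ℤ else 0ℤ) (+ d X) (+ d Y)
    where
    elsewhere : ∀ a p q → 1ℤ * (+ 0 - a) + -1ℤ * (+ 0 - a) ≡ p * 0ℤ + - q * 0ℤ
    elsewhere = solve-∀

  leafDiff : Vector ℤ (3 ℕ.+ ℓ)
  leafDiff = comb X Y 1ℤ -1ℤ

  M-leafDiff : ∀ j → matVec M leafDiff j ≡ comb X Y (+ d X) (- + d Y) j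
  M-leafDiff j = trans (dot-comb (M j) X Y 1ℤ -1ℤ) (twin-leaves j)

  VanishesOnLeaves : Vector ℤ (3 ℕ.+ ℓ) → Set
  VanishesOnLeaves y = y X ≡ 0ℤ × y Y ≡ 0ℤ

  LeafFreeRepresentation : Vector ℤ (3 ℕ.+ ℓ) → Set
  LeafFreeRepresentation x = Σ (Representation M last X x) (VanishesOnLeaves ∘ Representation.y)

  leaf-coefficient : ∀ {x} → ((ρ , _) : LeafFreeRepresentation x) → Representation.β ρ ≡ dot leafDiff x
  leaf-coefficient {x} (ρ , yX≡0 , yY≡0) = begin
    β
      ≡⟨ only-β α β ⟩
    0ℤ + (α * leafDiff last + β * leafDiff X)
      ≡⟨ cong (_+ (α * leafDiff last + β * leafDiff X)) leaf-term ⟨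
    dot (matVec M leafDiff) y + (α * leafDiff last + β * leafDiff X)
      ≡⟨ dot-representation M-sym ρ leafDiff ⟨
    dot leafDiff x ∎
    where
    open Representation ρ
    open ≡-Reasoning
    only-β : ∀ α β → β ≡ 0ℤ + (α * (1ℤ * 0ℤ + -1ℤ * 0ℤ) + β * (1ℤ * 1ℤ + -1ℤ * 0ℤ))
    only-β = solve-∀
    leaf-term : dot (matVec M leafDiff) y ≡ 0ℤ
    leaf-term = begin
      dot (matVec M leafDiff) y                 ≡⟨ dot-cong {x = y} M-leafDiff (λ _ → refl) ⟩
      dot (comb X Y (+ d X) (- + d Y)) y        ≡⟨ dot-comm (comb X Y (+ d X) (- + d Y)) y ⟩
      dot y (comb X Y (+ d X) (- + d Y))        ≡⟨ dot-comb y X Y (+ d X) (- + d Y) ⟩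
      + d X * y X + - + d Y * y Y               ≡⟨ cong₂ (λ s t → + d X * s + - + d Y * t) yX≡0 yY≡0 ⟩
      + d X * 0ℤ + - + d Y * 0ℤ                 ≡⟨ vanish (+ d X) (+ d Y) ⟩
      0ℤ                                        ∎
      where
      vanish : ∀ p q → p * 0ℤ + - q * 0ℤ ≡ 0ℤ
      vanish = solve-∀

  -- Index k is cleared by adding x_k times column k + 1 of M, which is −1 at k and vanishes
  -- at the indices 1 … k − 1; index 0 and the last index are never cleared.
  Cleared : ℕ → Vector ℤ (3 ℕ.+ ℓ) → Set
  Cleared k x = ∀ i → 1 ≤ toℕ i → toℕ i < k → x i ≡ 0ℤ

  cleared-step : ∀ {k} (x : Vector ℤ (3 ℕ.+ ℓ)) (p c : Fin (3 ℕ.+ ℓ)) → 1 ≤ k →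
                 toℕ p ≡ k → toℕ c ≡ suc k → Cleared k x → Cleared (suc k) (λ i → x i + x p * M i c)
  cleared-step {k} x p c 1≤k p≡k c≡1+k cleared i 1≤i i≤k with toℕ i ℕ.≟ k
  ... | yes i≡k = begin
    x i + x p * M i c    ≡⟨ cong₂ (λ s t → x s + x p * t) i≡p (M-next 1≤i (trans c≡1+k (cong suc (sym i≡k)))) ⟩
    x p + x p * -1ℤ      ≡⟨ cancel (x p) ⟩
    0ℤ                   ∎
    where
    open ≡-Reasoning
    i≡p : i ≡ p
    i≡p = Finₚ.toℕ-injective (trans i≡k (sym p≡k))
    cancel : ∀ a → a + a * -1ℤ ≡ 0ℤ
    cancel = solve-∀
  ... | no i≢k  = begin
    x i + x p * M i c
      ≡⟨ cong₂ (λ s t → s + x p * t) (cleared i 1≤i i<k) (M-far 1≤i i+2≤c) ⟩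
    0ℤ + x p * 0ℤ
      ≡⟨ vanish (x p) ⟩
    0ℤ ∎
    where
    open ≡-Reasoning
    i<k : toℕ i < k
    i<k = ℕₚ.≤∧≢⇒< (ℕₚ.≤-pred i≤k) i≢k
    i+2≤c : 2 ℕ.+ toℕ i ≤ toℕ c
    i+2≤c = subst (2 ℕ.+ toℕ i ≤_) (sym c≡1+k) (s≤s i<k)
    vanish : ∀ a → 0ℤ + a * 0ℤ ≡ 0ℤ
    vanish = solve-∀

  cleared-final : ∀ x → Cleared (2 ℕ.+ ℓ) x → LeafFreeRepresentation x
  cleared-final x cleared = record { y = λ _ → 0ℤ ; α = x last ; β = x X ; represents = represents } , refl , refl
    where
    on-support : ∀ i → x i ≡ comb last X (x last) (x X) i
    on-support zero = atX (x last) (x X)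
      where
      atX : ∀ a b → b ≡ a * 0ℤ + b * 1ℤ
      atX = solve-∀
    on-support (suc i) with suc i ≟ last
    ... | yes refl = atLast (x last) (x X)
      where
      atLast : ∀ a b → a ≡ a * 1ℤ + b * 0ℤ
      atLast = solve-∀
    ... | no i≢last = trans (cleared (suc i) (s≤s z≤n) i<2+ℓ) (elsewhere (x last) (x X))
      where
      i<2+ℓ : toℕ (suc i) < 2 ℕ.+ ℓ
      i<2+ℓ = ℕₚ.≤∧≢⇒< (ℕₚ.≤-pred (Finₚ.toℕ<n (suc i)))
                       (λ i≡2+ℓ → i≢last (Finₚ.toℕ-injective (trans i≡2+ℓ (sym (Finₚ.toℕ-fromℕ (2 ℕ.+ ℓ))))))
      elsewhere : ∀ a b → 0ℤ ≡ a * 0ℤ + b * 0ℤ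
      elsewhere = solve-∀
    represents : ∀ i → x i ≡ matVec M (λ _ → 0ℤ) i + comb last X (x last) (x X) i
    represents i = trans (on-support i)
      (sym (trans (cong (_+ comb last X (x last) (x X) i) (dot-zeroʳ (M i))) (ℤₚ.+-identityˡ _)))

  sweep-from : ∀ t k → t ℕ.+ k ≡ 2 ℕ.+ ℓ → 1 ≤ k → ∀ x → Cleared k x → LeafFreeRepresentation x
  sweep-from zero    k refl _   x cleared = cleared-final x cleared
  sweep-from (suc t) k t+k≡ 1≤k x cleared =
    unfire (x p) c ρ , leaf (proj₁ vanishes) X≢c , leaf (proj₂ vanishes) Y≢c
    where
    k<2+ℓ : k < 2 ℕ.+ ℓ
    k<2+ℓ = subst (k <_) t+k≡ (s≤s (ℕₚ.m≤n+m k t))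
    p c : Fin (3 ℕ.+ ℓ)
    p = fromℕ< (ℕₚ.m<n⇒m<1+n k<2+ℓ)
    c = fromℕ< (s≤s k<2+ℓ)
    c≡1+k : toℕ c ≡ suc k
    c≡1+k = Finₚ.toℕ-fromℕ< (s≤s k<2+ℓ)
    fired : LeafFreeRepresentation (λ i → x i + x p * M i c)
    fired = sweep-from t (suc k) (trans (ℕₚ.+-suc t k) t+k≡) (ℕₚ.m≤n⇒m≤1+n 1≤k) (λ i → x i + x p * M i c)
              (cleared-step x p c 1≤k (Finₚ.toℕ-fromℕ< _) c≡1+k cleared)
    ρ : Representation M last X (λ i → x i + x p * M i c)
    ρ = proj₁ fired
    vanishes : VanishesOnLeaves (Representation.y ρ)
    vanishes = proj₂ fired
    X≢c : X ≢ c
    X≢c X≡c = ℕₚ.0≢1+n (trans (cong toℕ X≡c) c≡1+k)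
    Y≢c : Y ≢ c
    Y≢c Y≡c = ℕₚ.<⇒≢ 1≤k (ℕₚ.suc-injective (trans (cong toℕ Y≡c) c≡1+k))
    leaf : ∀ {v} → Representation.y ρ v ≡ 0ℤ → v ≢ c → Representation.y ρ v + - x p * e c v ≡ 0ℤ
    leaf {v} yv≡0 v≢c = trans (cong₂ (λ s t → s + - x p * t) yv≡0 (e-other v≢c)) (vanish (x p))
      where
      vanish : ∀ a → 0ℤ + - a * 0ℤ ≡ 0ℤ
      vanish = solve-∀

  sweep : ∀ x → LeafFreeRepresentation x
  sweep x = sweep-from (suc ℓ) 1 (ℕₚ.+-comm (suc ℓ) 1) ℕₚ.≤-refl x
              (λ i 1≤i i<1 → contradiction (ℕₚ.≤-trans 1≤i (ℕₚ.≤-pred i<1)) λ ())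

module BidentCokernel (ℓ : ℕ) (d r : Fin (3 ℕ.+ ℓ) → ℕ)
  (dX>0 : 0 < d zero) (r-last>0 : 0 < r (fromℕ (2 ℕ.+ ℓ)))
  (Mr≡0 : ∀ i → matVec (lapl d (bidentAdj ℓ)) (λ j → + r j) i ≡ + 0)
  (r-primitive : Primitive r) where

  open Bident ℓ d public
  open ≡-Reasoning

  R : Vector ℤ (3 ℕ.+ ℓ)
  R j = + r j

  open TwoGeneratedCokernel M M-sym R Mr≡0 last X (proj₁ ∘ sweep) public

  instance
    R-last-nonZero : ℤ.NonZero (R last)
    R-last-nonZero = ℤ.≢-nonZero (λ R-last≡0 → ℕₚ.<⇒≢ r-last>0 (sym (ℤₚ.+-injective R-last≡0)))

  bézout-R : ∃₂ λ σ τ → + gcd ∣ R last ∣ ∣ R X ∣ ≡ σ * R last + τ * R X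
  bézout-R = bézout (R last) (R X)

  u v : ℤ
  u = proj₁ (proj₂ bézout-R)
  v = - proj₁ bézout-R

  uv : u * R X - v * R last ≡ 1ℤ
  uv = begin
    u * R X - - proj₁ bézout-R * R last   ≡⟨ reorder (proj₁ bézout-R) u (R last) (R X) ⟩
    proj₁ bézout-R * R last + u * R X     ≡⟨ proj₂ (proj₂ bézout-R) ⟨
    + gcd ∣ R last ∣ ∣ R X ∣              ≡⟨ cong +_ (ℕᵈ.∣1⇒≡1 (r-primitive (gcd ∣ R last ∣ ∣ R X ∣) gcd-∣-R)) ⟩
    1ℤ                                    ∎
    where
    reorder : ∀ σ τ L X → τ * X - - σ * L ≡ σ * L + τ * X
    reorder = solve-∀

  p : Vector ℤ (3 ℕ.+ ℓ)
  p i = Representation.α (proj₁ (sweep (e i)))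

  R-split : ∀ i → R i ≡ p i * R last + leafDiff i * R X
  R-split i = begin
    R i
      ≡⟨ dot-e R i ⟨
    dot R (e i)
      ≡⟨ R-representation (proj₁ (sweep (e i))) ⟩
    p i * R last + β * R X
      ≡⟨ cong (λ s → p i * R last + s * R X) (trans (leaf-coefficient (sweep (e i))) (dot-e leafDiff i)) ⟩
    p i * R last + leafDiff i * R X ∎
    where open Representation (proj₁ (sweep (e i)))

  -- b = (u R − leafDiff) / R last, integral by R-split.
  b : Vector ℤ (3 ℕ.+ ℓ)
  b i = u * p i + v * leafDiff i

  R-last*b : ∀ i → R last * b i ≡ u * R i + -1ℤ * leafDiff i
  R-last*b i = begin
    R last * (u * p i + v * leafDiff i)
      ≡⟨ expand (R last) (R X) u v (p i) (leafDiff i) ⟩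
    u * (p i * R last + leafDiff i * R X) - (u * R X - v * R last) * leafDiff i
      ≡⟨ cong₂ (λ s t → u * s - t * leafDiff i) (sym (R-split i)) uv ⟩
    u * R i - 1ℤ * leafDiff i
      ≡⟨ negate (u * R i) (leafDiff i) ⟩
    u * R i + -1ℤ * leafDiff i ∎
    where
    expand : ∀ L X u v p q → L * (u * p + v * q) ≡ u * (p * L + q * X) - (u * X - v * L) * q
    expand = solve-∀
    negate : ∀ a q → a - 1ℤ * q ≡ a + -1ℤ * q
    negate = solve-∀

  b-last : b last ≡ u
  b-last = ℤₚ.*-cancelˡ-≡ (R last) (b last) u (trans (R-last*b last) (atLast u (R last)))
    where
    atLast : ∀ u L → u * L + -1ℤ * (1ℤ * 0ℤ + -1ℤ * 0ℤ) ≡ L * u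
    atLast = solve-∀

  b-X : b X ≡ v
  b-X = ℤₚ.*-cancelˡ-≡ (R last) (b X) v (begin
    R last * b X                              ≡⟨ R-last*b X ⟩
    u * R X + -1ℤ * (1ℤ * 1ℤ + -1ℤ * 0ℤ)      ≡⟨ cong (λ s → u * R X + -1ℤ * s) (sym uv) ⟩
    u * R X + -1ℤ * (u * R X - v * R last)    ≡⟨ atX u v (R X) (R last) ⟩
    R last * v                                ∎)
    where
    atX : ∀ u v X L → u * X + -1ℤ * (u * X - v * L) ≡ L * v
    atX = solve-∀

  R-last*Mb : ∀ j → R last * matVec M b j ≡ - comb X Y (+ d X) (- + d Y) j
  R-last*Mb j = begin
    R last * matVec M b j
      ≡⟨ matVec-* M (R last) b j ⟨
    matVec M (λ i → R last * b i) j
      ≡⟨ matVec-cong M R-last*b j ⟩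
    matVec M (λ i → u * R i + -1ℤ * leafDiff i) j
      ≡⟨ matVec-+ M (λ i → u * R i) (λ i → -1ℤ * leafDiff i) j ⟩
    matVec M (λ i → u * R i) j + matVec M (λ i → -1ℤ * leafDiff i) j
      ≡⟨ cong₂ _+_ (matVec-* M u R j) (matVec-* M -1ℤ leafDiff j) ⟩
    u * matVec M R j + -1ℤ * matVec M leafDiff j
      ≡⟨ cong₂ (λ s t → u * s + -1ℤ * t) (Mr≡0 j) (M-leafDiff j) ⟩
    u * 0ℤ + -1ℤ * comb X Y (+ d X) (- + d Y) j
      ≡⟨ simplify u (comb X Y (+ d X) (- + d Y) j) ⟩
    - comb X Y (+ d X) (- + d Y) j ∎
    where
    simplify : ∀ u c → u * 0ℤ + -1ℤ * c ≡ - c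
    simplify = solve-∀

  sX sY : ℤ
  sX = matVec M b X
  sY = matVec M b Y

  Mb-on-leaves : ∀ j → matVec M b j ≡ comb X Y sX sY j
  Mb-on-leaves zero          = atX sX sY
    where
    atX : ∀ s t → s ≡ s * 1ℤ + t * 0ℤ
    atX = solve-∀
  Mb-on-leaves (suc zero)    = atY sX sY
    where
    atY : ∀ s t → t ≡ s * 0ℤ + t * 1ℤ
    atY = solve-∀
  Mb-on-leaves (suc (suc k)) = ℤₚ.*-cancelˡ-≡ (R last) _ _ (begin
    R last * matVec M b (suc (suc k))          ≡⟨ R-last*Mb (suc (suc k)) ⟩
    - (+ d X * 0ℤ + - + d Y * 0ℤ)              ≡⟨ vanish (R last) (+ d X) (+ d Y) sX sY ⟩
    R last * (sX * 0ℤ + sY * 0ℤ)               ∎)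
    where
    vanish : ∀ L p q s t → - (p * 0ℤ + - q * 0ℤ) ≡ L * (s * 0ℤ + t * 0ℤ)
    vanish = solve-∀

  sX≢0 : sX ≢ 0ℤ
  sX≢0 sX≡0 = ℕₚ.<⇒≢ dX>0 (sym (ℤₚ.+-injective (begin
    + d X                              ≡⟨ atX (+ d X) (+ d Y) ⟨
    - - (+ d X * 1ℤ + - + d Y * 0ℤ)     ≡⟨ cong -_ (R-last*Mb X) ⟨
    - (R last * sX)                    ≡⟨ cong (λ s → - (R last * s)) sX≡0 ⟩
    - (R last * 0ℤ)                    ≡⟨ cong -_ (ℤₚ.*-zeroʳ (R last)) ⟩
    0ℤ                                 ∎)))
    where
    atX : ∀ p q → - - (p * 1ℤ + - q * 0ℤ) ≡ p
    atX = solve-∀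

  m : ℕ
  m = gcd ∣ sX ∣ ∣ sY ∣

  m>0 : 0 < m
  m>0 = ℕₚ.n≢0⇒n>0 (gcd[m,n]≢0 ∣ sX ∣ ∣ sY ∣ (inj₁ (sX≢0 ∘ ℤₚ.∣i∣≡0⇒i≡0)))

  m∣Mb : ∀ j → + m ℤᵈ.∣ matVec M b j
  m∣Mb j = subst (+ m ℤᵈ.∣_) (sym (Mb-on-leaves j))
    (ℤᵈ.∣m∣n⇒∣m+n (ℤᵈ.∣m⇒∣m*n (e X j) (gcd-∣ˡ sX sY)) (ℤᵈ.∣m⇒∣m*n (e Y j) (gcd-∣ʳ sX sY)))

  bézout-Mb : ∃₂ λ σ τ → + m ≡ σ * sX + τ * sY
  bézout-Mb = bézout sX sY

  σ τ : ℤ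
  σ = proj₁ bézout-Mb
  τ = proj₁ (proj₂ bézout-Mb)

  z₀ : Vector ℤ (3 ℕ.+ ℓ)
  z₀ = comb X Y σ τ

  open Representation (proj₁ (sweep (matVec M z₀)))
    renaming (y to y₀; α to α₀; β to β₀; represents to Mz₀-represented)

  z : Vector ℤ (3 ℕ.+ ℓ)
  z j = z₀ j + -1ℤ * y₀ j

  Mz-comb : ∀ j → matVec M z j ≡ comb last X α₀ β₀ j
  Mz-comb j = begin
    matVec M z j                                           ≡⟨ matVec-+ M z₀ (λ i → -1ℤ * y₀ i) j ⟩
    matVec M z₀ j + matVec M (λ i → -1ℤ * y₀ i) j          ≡⟨ cong₂ _+_ (Mz₀-represented j) (matVec-* M -1ℤ y₀ j) ⟩
    (matVec M y₀ j + comb last X α₀ β₀ j) + -1ℤ * matVec M y₀ j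
                                                           ≡⟨ cancel (matVec M y₀ j) (comb last X α₀ β₀ j) ⟩
    comb last X α₀ β₀ j                                    ∎
    where
    cancel : ∀ a c → (a + c) + -1ℤ * a ≡ c
    cancel = solve-∀

  z-on-leaves : z X ≡ σ × z Y ≡ τ
  z-on-leaves = trans (cong (λ s → σ * 1ℤ + τ * 0ℤ + -1ℤ * s) (proj₁ y₀-vanishes)) (atX σ τ) ,
                trans (cong (λ s → σ * 0ℤ + τ * 1ℤ + -1ℤ * s) (proj₂ y₀-vanishes)) (atY σ τ)
    where
    y₀-vanishes : VanishesOnLeaves y₀
    y₀-vanishes = proj₂ (sweep (matVec M z₀))
    atX : ∀ σ τ → σ * 1ℤ + τ * 0ℤ + -1ℤ * 0ℤ ≡ σ
    atX = solve-∀
    atY : ∀ σ τ → σ * 0ℤ + τ * 1ℤ + -1ℤ * 0ℤ ≡ τ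
    atY = solve-∀

  b-torsion : α₀ * u + β₀ * v ≡ + m
  b-torsion = begin
    α₀ * u + β₀ * v                 ≡⟨ cong₂ (λ s t → α₀ * s + β₀ * t) b-last b-X ⟨
    α₀ * b last + β₀ * b X          ≡⟨ dot-comb b last X α₀ β₀ ⟨
    dot b (comb last X α₀ β₀)       ≡⟨ dot-cong {a = b} (λ _ → refl) Mz-comb ⟨
    dot b (matVec M z)              ≡⟨ dot-matVec M M-sym b z ⟩
    dot (matVec M b) z              ≡⟨ dot-cong {x = z} Mb-on-leaves (λ _ → refl) ⟩
    dot (comb X Y sX sY) z          ≡⟨ dot-comm (comb X Y sX sY) z ⟩
    dot z (comb X Y sX sY)          ≡⟨ dot-comb z X Y sX sY ⟩
    sX * z X + sY * z Y             ≡⟨ cong₂ (λ s t → sX * s + sY * t) (proj₁ z-on-leaves) (proj₂ z-on-leaves) ⟩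
    sX * σ + sY * τ                 ≡⟨ cong₂ _+_ (ℤₚ.*-comm sX σ) (ℤₚ.*-comm sY τ) ⟩
    σ * sX + τ * sY                 ≡⟨ proj₂ (proj₂ bézout-Mb) ⟨
    + m                             ∎

  R-torsion : α₀ * R last + β₀ * R X ≡ 0ℤ
  R-torsion = begin
    α₀ * R last + β₀ * R X          ≡⟨ dot-comb R last X α₀ β₀ ⟨
    dot R (comb last X α₀ β₀)       ≡⟨ dot-cong {a = R} (λ _ → refl) Mz-comb ⟨
    dot R (matVec M z)              ≡⟨ R-image z ⟩
    0ℤ                              ∎

  Mz : ∀ i → matVec M z i ≡ comb last X (+ m * R X) (- (+ m * R last)) i
  Mz i = trans (Mz-comb i) (cong₂ (λ s t → s * e last i + t * e X i)
    (trans (proj₁ multiple) (cong (_* R X) b-torsion))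
    (trans (proj₂ multiple) (cong (λ s → - (s * R last)) b-torsion)))
    where
    multiple : α₀ ≡ (α₀ * u + β₀ * v) * R X × β₀ ≡ - ((α₀ * u + β₀ * v) * R last)
    multiple = orthogonal-to-unimodular {R last} {R X} {u} {v} {α₀} {β₀} uv R-torsion

proposition5p1 : (ℓ : ℕ) (d r : Fin (3 ℕ.+ ℓ) → ℕ) →
    IsArithmetical (bidentAdj ℓ) d r →
    CriticalGroupCyclic (lapl d (bidentAdj ℓ))
proposition5p1 ℓ d r (d>0 , r>0 , Mr≡0 , r-primitive) = cyclic uv b b-last b-X m m>0 m∣Mb z Mz
  where open BidentCokernel ℓ d r (d>0 zero) (r>0 (fromℕ (2 ℕ.+ ℓ))) Mr≡0 r-primitive
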